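{- Let $G$ be a graph with $mad(G)<3$ and $ch_3^d(G)\ge 9$ having the smallest number of vertices and edges among all such graphs. Then for $k\in\{4,5\}$, every vertex of degree $k$ in $G$ has at most $k-2$ neighbors of degree $2$.
   Context: A 3-dynamic coloring of a graph $G$ is a proper vertex coloring such that every vertex $v$ sees at least $\min\{3,\deg_G(v)\}$ distinct colors in $N_G(v)$. $ch_3^d(G)$ is the least $k$ such that for every list assignment $L$ with $|L(v)|\ge k$ for all $v$, $G$ has a 3-dynamic coloring $\phi$ with $\phi(v)\in L(v)$ for all $v$. $mad(G)$ is the maximum of $2|E(H)|/|V(H)|$ over nonempty subgraphs $H$ of $G$. -}

module Defs where

open import Data.Bool using (Bool; true; false; T)
open import Data.Nat using (ℕ; _+_; _*_; _≤_; _<_; _⊔_) renaming (_≡ᵇ_ to _==_ ; _<ᵇ_ to _<ᵇ_)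
open import Data.Nat.Properties using (_≟_)
open import Data.Fin using (Fin; toℕ)
open import Data.List using (List; length; filterᵇ; deduplicate; map; concatMap; allFin)
open import Data.List.Membership.Propositional using (_∈_)
open import Data.List.Relation.Unary.Unique.Propositional using (Unique)
open import Data.Product using (Σ; _×_; ∃)
open import Relation.Binary.PropositionalEquality using (_≡_; _≢_)
open import Relation.Nullary using (¬_)

record Graph : Set where
  field
    n       : ℕ
    adj     : Fin n → Fin n → Bool
    sym     : ∀ u v → adj u v ≡ adj v u
    irrefl  : ∀ v → adj v v ≡ false
open Graph public

countFin : (m : ℕ) → (Fin m → Bool) → ℕ
countFin m p = length (filterᵇ p (allFin m))

countPairs : (m : ℕ) → (Fin m → Fin m → Bool) → ℕ
countPairs m r =
  length (concatMap (λ i → filterᵇ (λ j → (toℕ i <ᵇ toℕ j) Data.Bool.∧ r i j) (allFin m)) (allFin m))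

deg : (G : Graph) → Fin (n G) → ℕ
deg G v = countFin (n G) (adj G v)

numV : Graph → ℕ
numV G = n G

numE : Graph → ℕ
numE G = countPairs (n G) (adj G)

record Subgraph (G : Graph) : Set where
  field
    S      : Fin (n G) → Bool
    E      : Fin (n G) → Fin (n G) → Bool
    Esym   : ∀ u v → E u v ≡ E v u
    E⊆adj  : ∀ u v → T (E u v) → T (adj G u v)
    E⊆S    : ∀ u v → T (E u v) → T (S u) × T (S v)
open Subgraph public

subV : {G : Graph} → Subgraph G → ℕ
subV {G} H = countFin (n G) (S H)

subE : {G : Graph} → Subgraph G → ℕ
subE {G} H = countPairs (n G) (E H)

-- mad(G) < 3 : every nonempty subgraph H has 2|E(H)|/|V(H)| < 3
madLt3 : Graph → Set
madLt3 G = (H : Subgraph G) → 1 ≤ subV H → 2 * subE H < 3 * subV H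

ListAssignment : Graph → Set
ListAssignment G = Fin (n G) → List ℕ

min : ℕ → ℕ → ℕ
min a b = Data.Nat._⊓_ a b

coloursSeen : (G : Graph) → (Fin (n G) → ℕ) → Fin (n G) → ℕ
coloursSeen G φ v = length (deduplicate _≟_ (map φ (filterᵇ (adj G v) (allFin (n G)))))

Is3Dynamic : (G : Graph) → (Fin (n G) → ℕ) → Set
Is3Dynamic G φ =
  (∀ u v → T (adj G u v) → φ u ≢ φ v) ×
  (∀ v → min 3 (deg G v) ≤ coloursSeen G φ v)

Choosable3d : Graph → ℕ → Set
Choosable3d G k =
  (L : ListAssignment G) → (∀ v → Unique (L v)) → (∀ v → k ≤ length (L v)) →
  Σ (Fin (n G) → ℕ) (λ φ → (∀ v → φ v ∈ L v) × Is3Dynamic G φ)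

-- ch_3^d(G) ≥ m : every k for which G is 3-dynamically k-choosable is ≥ m
-- (equivalently, the least such k is ≥ m)
ch3dGe : Graph → ℕ → Set
ch3dGe G m = ∀ k → Choosable3d G k → m ≤ k

Bad : Graph → Set
Bad G = madLt3 G × ch3dGe G 9

MinimalBad : Graph → Set
MinimalBad G = Bad G × (∀ G' → Bad G' → numV G + numE G ≤ numV G' + numE G')

deg2Nbrs : (G : Graph) → Fin (n G) → ℕ
deg2Nbrs G v = countFin (n G) (λ u → adj G v u Data.Bool.∧ (deg G u == 2))

-- Let v have degree d + 1 ∈ {4, 5} and d neighbours u₁, …, u_d of degree 2, and put K = {v, u₁, …, u_d}.
-- Deleting the edges at v gives a smaller graph with mad < 3, so by minimality it has a 3-dynamic colouring φ
-- from any 8-lists.  Keep φ off K and recolour K greedily, choosing for v a colour outside φ(wᵢ) for the other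
-- neighbour wᵢ of each uᵢ, and outside φ(y) and two colours that y sees outside K for the remaining neighbour y
-- (at most d + 3 ≤ 7 colours); then for each uᵢ a colour different from those of v and of the other uⱼ and
-- outside φ(wᵢ) and two colours that wᵢ sees outside K (at most 7 colours).  Now v sees the d ≥ 3 colours of
-- the uᵢ, and uᵢ sees two colours.  A vertex outside K either still sees three colours outside K, or it sees the
-- at most two colours it sees there together with the pairwise distinct new colours of its neighbours in K,
-- which avoid them.  So G would be 3-dynamically 8-choosable.

module Submission where

open import Defs hiding (sym)
open import Data.Bool using (Bool; true; false; T; T?; not; _∧_)
open import Data.Bool.Properties using (T-∧)
open import Data.Empty using (⊥; ⊥-elim)
open import Data.Fin using (Fin; toℕ; fromℕ<) renaming (_≟_ to _≟ᶠ_)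
open import Data.Fin.Properties using (toℕ-injective)
open import Data.List using (List; []; _∷_; length; filter; filterᵇ; deduplicate; map; concatMap; _++_; take; allFin)
open import Data.List.Properties using (length-++; length-map; length-take; take-all; filter-notAll)
open import Data.List.Membership.Propositional using (_∈_; _∉_; find; lose)
open import Data.List.Membership.Propositional.Properties
  using (∈-filter⁺; ∈-filter⁻; ∈-concat⁺′; ∈-map⁺; ∈-map⁻; ∈-deduplicate⁺; ∈-deduplicate⁻; ∈-++⁺ˡ; ∈-++⁺ʳ; ∈-++⁻;
         ∈-allFin; ∈-lookup)
import Data.List.Membership.DecPropositional as DecMembership
open import Data.List.Relation.Binary.Subset.Propositional using (_⊆_)
open import Data.List.Relation.Binary.Subset.Propositional.Properties using () renaming (map⁺ to ⊆-map⁺)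
import Data.List.Relation.Binary.Sublist.Propositional as Sublist
import Data.List.Relation.Binary.Sublist.Setoid.Properties as SublistProperties
open import Data.List.Relation.Unary.All as All using (All; []; _∷_)
open import Data.List.Relation.Unary.Any as Any using (Any; here; there; any?)
open import Data.List.Relation.Unary.Unique.Propositional using (Unique; []; _∷_)
open import Data.List.Relation.Unary.Unique.Propositional.Properties as Unique using ()
open import Data.List.Relation.Unary.Unique.DecPropositional.Properties using (deduplicate-!)
open import Data.Nat using (ℕ; suc; _+_; _*_; _≤_; _<_; _⊓_; z≤n; s≤s; s≤s⁻¹; _<ᵇ_; _≡ᵇ_)
open import Data.Nat.Properties as ℕ
  using (≤-refl; ≤-trans; <-≤-trans; ≤-pred; <-irrefl; <⇒≱; ≰⇒>; _≤?_; <-cmp; <⇒<ᵇ; ≡ᵇ⇒≡; m≤n⇒m≤1+n; n≤1+n;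
         n<1+n; m≤m+n; +-comm; +-assoc; +-suc; +-mono-≤; +-monoˡ-≤; +-monoʳ-≤; +-monoʳ-<; +-mono-<-≤; +-mono-≤-<;
         +-cancelʳ-≤; *-monoˡ-≤; m⊓n≤m; ⊓-monoˡ-≤; ⊓-monoʳ-≤; +-distribʳ-⊓; m≤n⇒m⊓n≡m; m≤n⇒∃[o]m+o≡n;
         module ≤-Reasoning)
open import Data.Product using (Σ; ∃-syntax; _×_; _,_; proj₁; proj₂)
open import Data.Sum using (_⊎_; inj₁; inj₂)
open import Data.Vec.Functional using (updateAt)
open import Data.Vec.Functional.Properties using (updateAt-updates; updateAt-minimal)
open import Function using (_∘_; const)
open import Function.Bundles using (Equivalence)
open import Relation.Binary.Definitions using (DecidableEquality; Tri; tri<; tri≈; tri>)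
open import Relation.Binary.PropositionalEquality
  using (_≡_; _≢_; refl; sym; trans; subst; subst₂; cong; cong₂; setoid)
open import Relation.Nullary using (¬_; yes; no; contradiction)
open import Relation.Nullary.Decidable
  using (¬?; decidable-stable; isYes; fromWitness; toWitness; fromWitnessFalse; toWitnessFalse)

InjectiveOn : {A B : Set} → (A → B) → List A → Set
InjectiveOn f xs = ∀ {x y} → x ∈ xs → y ∈ xs → f x ≡ f y → x ≡ y

module _ {A B : Set} where

  map⁺-injectiveOn : {f : A → B} {xs : List A} → Unique xs → InjectiveOn f xs → Unique (map f xs)
  map⁺-injectiveOn {xs = []} [] inj = []
  map⁺-injectiveOn {f} {x ∷ xs} (x∉xs ∷ u) inj =
    All.tabulate (λ fy∈ fx≡fy → let y , y∈xs , fy≡ = ∈-map⁻ f fy∈ in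
                    All.lookup x∉xs y∈xs (inj (here refl) (there y∈xs) (trans fx≡fy fy≡)))
    ∷ map⁺-injectiveOn u (λ x∈ y∈ → inj (there x∈) (there y∈))

  length-concatMap-≤ : (f : A → List B) (c : ℕ) (xs : List A) →
    (∀ {x} → x ∈ xs → length (f x) ≤ c) → length (concatMap f xs) ≤ length xs * c
  length-concatMap-≤ f c [] bound = z≤n
  length-concatMap-≤ f c (x ∷ xs) bound rewrite length-++ (f x) {concatMap f xs} =
    +-mono-≤ (bound (here refl)) (length-concatMap-≤ f c xs (λ y∈xs → bound (there y∈xs)))

  ∈-concatMap⁺ : (f : A → List B) {x : A} {xs : List A} {y : B} → x ∈ xs → y ∈ f x → y ∈ concatMap f xs
  ∈-concatMap⁺ f x∈xs y∈fx = ∈-concat⁺′ y∈fx (∈-map⁺ f x∈xs)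

  length-concatMap-mono : (f g : A → List B) → (∀ x → length (f x) ≤ length (g x)) →
    ∀ xs → length (concatMap f xs) ≤ length (concatMap g xs)
  length-concatMap-mono f g f≤g [] = z≤n
  length-concatMap-mono f g f≤g (x ∷ xs)
    rewrite length-++ (f x) {concatMap f xs} | length-++ (g x) {concatMap g xs} =
    +-mono-≤ (f≤g x) (length-concatMap-mono f g f≤g xs)

  length-concatMap-mono-< : (f g : A → List B) → (∀ x → length (f x) ≤ length (g x)) →
    ∀ {x xs} → x ∈ xs → length (f x) < length (g x) → length (concatMap f xs) < length (concatMap g xs)
  length-concatMap-mono-< f g f≤g {xs = y ∷ ys} (here refl) fx<gx
    rewrite length-++ (f y) {concatMap f ys} | length-++ (g y) {concatMap g ys} =
    +-mono-<-≤ fx<gx (length-concatMap-mono f g f≤g ys)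
  length-concatMap-mono-< f g f≤g {xs = y ∷ ys} (there x∈ys) fx<gx
    rewrite length-++ (f y) {concatMap f ys} | length-++ (g y) {concatMap g ys} =
    +-mono-≤-< (f≤g y) (length-concatMap-mono-< f g f≤g x∈ys fx<gx)

module _ {A : Set} where

  length-filterᵇ-mono : {p q : A → Bool} → (∀ x → T (p x) → T (q x)) →
    ∀ xs → length (filterᵇ p xs) ≤ length (filterᵇ q xs)
  length-filterᵇ-mono p⇒q [] = z≤n
  length-filterᵇ-mono {p} {q} p⇒q (x ∷ xs) with p x in px | q x in qx
  ... | true  | true  = s≤s (length-filterᵇ-mono p⇒q xs)
  ... | true  | false = ⊥-elim (subst T qx (p⇒q x (subst T (sym px) _)))
  ... | false | true  = m≤n⇒m≤1+n (length-filterᵇ-mono p⇒q xs)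
  ... | false | false = length-filterᵇ-mono p⇒q xs

  length-filterᵇ-mono-< : {p q : A → Bool} → (∀ x → T (p x) → T (q x)) →
    ∀ {x xs} → x ∈ xs → ¬ T (p x) → T (q x) → length (filterᵇ p xs) < length (filterᵇ q xs)
  length-filterᵇ-mono-< {p} {q} p⇒q {xs = y ∷ ys} (here refl) ¬py qy with p y | q y
  ... | true  | _     = ⊥-elim (¬py _)
  ... | false | true  = s≤s (length-filterᵇ-mono p⇒q ys)
  length-filterᵇ-mono-< {p} {q} p⇒q {xs = y ∷ ys} (there x∈ys) ¬px qx with p y in py | q y in qy
  ... | true  | true  = s≤s (length-filterᵇ-mono-< p⇒q x∈ys ¬px qx)
  ... | true  | false = ⊥-elim (subst T qy (p⇒q y (subst T (sym py) _)))
  ... | false | true  = m≤n⇒m≤1+n (length-filterᵇ-mono-< p⇒q x∈ys ¬px qx)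
  ... | false | false = length-filterᵇ-mono-< p⇒q x∈ys ¬px qx

  length-filterᵇ-partition : (p : A → Bool) (xs : List A) →
    length (filterᵇ (not ∘ p) xs) + length (filterᵇ p xs) ≡ length xs
  length-filterᵇ-partition p [] = refl
  length-filterᵇ-partition p (x ∷ xs) with p x
  ... | true  = trans (+-suc _ _) (cong suc (length-filterᵇ-partition p xs))
  ... | false = cong suc (length-filterᵇ-partition p xs)

  ∈-filterᵇ⁺ : (p : A → Bool) {x : A} {xs : List A} → x ∈ xs → T (p x) → x ∈ filterᵇ p xs
  ∈-filterᵇ⁺ p = ∈-filter⁺ (T? ∘ p)

  ∈-filterᵇ⁻ : (p : A → Bool) {x : A} {xs : List A} → x ∈ filterᵇ p xs → x ∈ xs × T (p x)
  ∈-filterᵇ⁻ p {xs = xs} = ∈-filter⁻ (T? ∘ p) {xs = xs}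

  ∈-take⁻ : (k : ℕ) (xs : List A) {x : A} → x ∈ take k xs → x ∈ xs
  ∈-take⁻ k xs = Sublist.lookup (SublistProperties.take-⊆ (setoid A) k xs)

module WithDecidableEquality {A : Set} (_≟_ : DecidableEquality A) where

  open DecMembership _≟_ using (_∈?_)

  Unique-⊆⇒length-≤ : {xs ys : List A} → Unique xs → xs ⊆ ys → length xs ≤ length ys
  Unique-⊆⇒length-≤ [] xs⊆ys = z≤n
  Unique-⊆⇒length-≤ {x ∷ xs} {ys} (x∉xs ∷ u) x∷xs⊆ys =
    <-≤-trans (s≤s (Unique-⊆⇒length-≤ u xs⊆ys-x)) ys-x<ys
    where
    ys-x = filter (λ y → ¬? (y ≟ x)) ys
    xs⊆ys-x : xs ⊆ ys-x
    xs⊆ys-x y∈xs = ∈-filter⁺ (λ y → ¬? (y ≟ x)) (x∷xs⊆ys (there y∈xs)) (λ y≡x → All.lookup x∉xs y∈xs (sym y≡x))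
    ys-x<ys : length ys-x < length ys
    ys-x<ys = filter-notAll _ ys (Any.map (λ x≡y y≢x → y≢x (sym x≡y)) (x∷xs⊆ys (here refl)))

  length-deduplicate-≥ : {zs xs : List A} → Unique zs → zs ⊆ xs → length zs ≤ length (deduplicate _≟_ xs)
  length-deduplicate-≥ u zs⊆xs = Unique-⊆⇒length-≤ u (λ z∈zs → ∈-deduplicate⁺ _≟_ (zs⊆xs z∈zs))

  length-deduplicate-≤ : {xs ys : List A} → xs ⊆ ys → length (deduplicate _≟_ xs) ≤ length ys
  length-deduplicate-≤ {xs} xs⊆ys =
    Unique-⊆⇒length-≤ (deduplicate-! _≟_ xs) (λ z∈ → xs⊆ys (∈-deduplicate⁻ _≟_ xs z∈))

  fresh : {xs ys : List A} → Unique xs → length ys < length xs → ∃[ x ] x ∈ xs × x ∉ ys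
  fresh {xs} {ys} u ys<xs with any? (λ x → ¬? (x ∈? ys)) xs
  ... | yes some = find some
  ... | no none = contradiction (Unique-⊆⇒length-≤ u xs⊆ys) (<⇒≱ ys<xs)
    where
    xs⊆ys : xs ⊆ ys
    xs⊆ys {x} x∈xs = decidable-stable (x ∈? ys) (λ x∉ys → none (lose x∈xs x∉ys))

  ∃-∈-≢ : {xs : List A} → Unique xs → 2 ≤ length xs → ∀ x → ∃[ w ] w ∈ xs × w ≢ x
  ∃-∈-≢ {_ ∷ []} _ (s≤s ()) _
  ∃-∈-≢ {a ∷ b ∷ _} (a∉ ∷ _) _ x with a ≟ x
  ... | yes refl = b , there (here refl) , λ b≡a → All.lookup a∉ (here refl) (sym b≡a)
  ... | no a≢x   = a , here refl , a≢x

open WithDecidableEquality ℕ._≟_ using (fresh; length-deduplicate-≥; length-deduplicate-≤)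

record DistinctChoice {m : ℕ} (L B : Fin m → List ℕ) (f : Fin m → ℕ) (xs : List (Fin m)) : Set where
  field
    colour    : Fin m → ℕ
    unchanged : ∀ {x} → x ∉ xs → colour x ≡ f x
    allowed   : ∀ {x} → x ∈ xs → colour x ∈ L x
    avoids    : ∀ {x} → x ∈ xs → colour x ∉ B x
    injective : InjectiveOn colour xs

-- Colours are chosen from the end of xs: the head avoids B and the length xs - 1 colours of the tail.
distinctChoice : {m : ℕ} (L B : Fin m → List ℕ) → (∀ x → Unique (L x)) → (f : Fin m → ℕ) →
  {xs : List (Fin m)} → Unique xs → (∀ {x} → x ∈ xs → length (B x) + length xs ≤ length (L x)) →
  DistinctChoice L B f xs
distinctChoice L B L-unique f [] room = record
  { colour = f ; unchanged = λ _ → refl ; allowed = λ () ; avoids = λ () ; injective = λ () }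
distinctChoice {m} L B L-unique f {x ∷ xs} (x∉xs ∷ xs-unique) room = record
  { colour    = colour′
  ; unchanged = unchanged′
  ; allowed   = allowed′
  ; avoids    = avoids′
  ; injective = injective′
  }
  where
  open DistinctChoice (distinctChoice L B L-unique f xs-unique
         (λ y∈xs → ≤-trans (+-monoʳ-≤ _ (n≤1+n _)) (room (there y∈xs))))

  open ≤-Reasoning
  room-x : length (map colour xs ++ B x) < length (L x)
  room-x = begin-strict
    length (map colour xs ++ B x)          ≡⟨ length-++ (map colour xs) ⟩
    length (map colour xs) + length (B x)  ≡⟨ cong (_+ length (B x)) (length-map colour xs) ⟩
    length xs + length (B x)               ≡⟨ +-comm (length xs) _ ⟩
    length (B x) + length xs               <⟨ +-monoʳ-< (length (B x)) (n<1+n _) ⟩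
    length (B x) + suc (length xs)         ≤⟨ room (here refl) ⟩
    length (L x)                           ∎

  c-fresh : ∃[ c ] c ∈ L x × c ∉ map colour xs ++ B x
  c-fresh = fresh (L-unique x) room-x

  c : ℕ
  c = proj₁ c-fresh

  colour′ : Fin m → ℕ
  colour′ = updateAt colour x (const c)

  colour′-x : colour′ x ≡ c
  colour′-x = updateAt-updates x colour

  colour′-xs : ∀ {y} → y ∈ xs → colour′ y ≡ colour y
  colour′-xs y∈xs = updateAt-minimal _ x colour (λ y≡x → All.lookup x∉xs y∈xs (sym y≡x))

  c∉colours : ∀ {y} → y ∈ xs → c ≢ colour y
  c∉colours y∈xs c≡ = proj₂ (proj₂ c-fresh) (∈-++⁺ˡ (subst (_∈ _) (sym c≡) (∈-map⁺ colour y∈xs)))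

  unchanged′ : ∀ {y} → y ∉ x ∷ xs → colour′ y ≡ f y
  unchanged′ y∉ = trans (updateAt-minimal _ x colour (λ y≡x → y∉ (here y≡x))) (unchanged (λ y∈xs → y∉ (there y∈xs)))

  allowed′ : ∀ {y} → y ∈ x ∷ xs → colour′ y ∈ L y
  allowed′ (here refl)  = subst (_∈ L x) (sym colour′-x) (proj₁ (proj₂ c-fresh))
  allowed′ (there y∈xs) = subst (_∈ L _) (sym (colour′-xs y∈xs)) (allowed y∈xs)

  avoids′ : ∀ {y} → y ∈ x ∷ xs → colour′ y ∉ B y
  avoids′ (here refl) rewrite colour′-x = λ c∈B → proj₂ (proj₂ c-fresh) (∈-++⁺ʳ _ c∈B)
  avoids′ (there y∈xs) rewrite colour′-xs y∈xs = avoids y∈xs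

  injective′ : InjectiveOn colour′ (x ∷ xs)
  injective′ (here refl) (here refl) _ = refl
  injective′ (here refl) (there z∈xs) eq =
    contradiction (trans (sym colour′-x) (trans eq (colour′-xs z∈xs))) (c∉colours z∈xs)
  injective′ (there y∈xs) (here refl) eq =
    contradiction (trans (sym colour′-x) (trans (sym eq) (colour′-xs y∈xs))) (c∉colours y∈xs)
  injective′ (there y∈xs) (there z∈xs) eq =
    injective y∈xs z∈xs (trans (sym (colour′-xs y∈xs)) (trans eq (colour′-xs z∈xs)))

module _ (G : Graph) where

  nbrs : Fin (n G) → List (Fin (n G))
  nbrs y = filterᵇ (adj G y) (allFin (n G))

  ∈-nbrs⁺ : ∀ y {z} → T (adj G y z) → z ∈ nbrs y
  ∈-nbrs⁺ y yz = ∈-filterᵇ⁺ (adj G y) (∈-allFin _) yz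

  ∈-nbrs⁻ : ∀ y {z} → z ∈ nbrs y → T (adj G y z)
  ∈-nbrs⁻ y z∈ = proj₂ (∈-filterᵇ⁻ (adj G y) {xs = allFin (n G)} z∈)

  nbrs-unique : ∀ y → Unique (nbrs y)
  nbrs-unique y = Unique.filter⁺ _ (Unique.allFin⁺ (n G))

  adj-sym : ∀ {y z} → T (adj G y z) → T (adj G z y)
  adj-sym {y} {z} yz = subst T (Graph.sym G y z) yz

  adj⇒≢ : ∀ {y z} → T (adj G y z) → y ≢ z
  adj⇒≢ {y} yy refl = subst T (irrefl G y) yy

adjAvoiding : (G : Graph) → Fin (n G) → Fin (n G) → Fin (n G) → Bool
adjAvoiding G v a b with a ≟ᶠ v | b ≟ᶠ v
... | no _ | no _ = adj G a b
... | _    | _    = false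

isolate : (G : Graph) → Fin (n G) → Graph
isolate G v = record
  { n      = n G
  ; adj    = adjAvoiding G v
  ; sym    = symmetric
  ; irrefl = irreflexive
  }
  where
  symmetric : ∀ a b → adjAvoiding G v a b ≡ adjAvoiding G v b a
  symmetric a b with a ≟ᶠ v | b ≟ᶠ v
  ... | no _  | no _  = Graph.sym G a b
  ... | yes _ | yes _ = refl
  ... | yes _ | no _  = refl
  ... | no _  | yes _ = refl

  irreflexive : ∀ a → adjAvoiding G v a a ≡ false
  irreflexive a with a ≟ᶠ v
  ... | no _  = irrefl G a
  ... | yes _ = refl

countPairs-mono-< : {m : ℕ} {r s : Fin m → Fin m → Bool} → (∀ i j → T (r i j) → T (s i j)) →
  ∀ {i j} → toℕ i < toℕ j → ¬ T (r i j) → T (s i j) → countPairs m r < countPairs m s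
countPairs-mono-< {m} {r} {s} r⇒s {i} {j} i<j ¬rij sij =
  length-concatMap-mono-< (orderedPairsFrom r) (orderedPairsFrom s)
    (λ k → length-filterᵇ-mono (ordered⇒ k) (allFin m))
    (∈-allFin i)
    (length-filterᵇ-mono-< (ordered⇒ i) (∈-allFin j)
      (λ t → ¬rij (proj₂ (Equivalence.to T-∧ t)))
      (Equivalence.from T-∧ (<⇒<ᵇ i<j , sij)))
  where
  orderedPairsFrom : (Fin m → Fin m → Bool) → Fin m → List (Fin m)
  orderedPairsFrom t k = filterᵇ (λ l → (toℕ k <ᵇ toℕ l) ∧ t k l) (allFin m)

  ordered⇒ : ∀ k l → T ((toℕ k <ᵇ toℕ l) ∧ r k l) → T ((toℕ k <ᵇ toℕ l) ∧ s k l)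
  ordered⇒ k l t with Equivalence.to T-∧ t
  ... | k<l , rkl = Equivalence.from T-∧ (k<l , r⇒s k l rkl)

module _ (G : Graph) (v : Fin (n G)) where

  isolate-adj⁻ : ∀ {a b} → T (adj (isolate G v) a b) → T (adj G a b)
  isolate-adj⁻ {a} {b} ab with a ≟ᶠ v | b ≟ᶠ v
  ... | no _  | no _  = ab
  ... | yes _ | _     = ⊥-elim ab
  ... | no _  | yes _ = ⊥-elim ab

  isolate-adj⁺ : ∀ {a b} → a ≢ v → b ≢ v → T (adj G a b) → T (adj (isolate G v) a b)
  isolate-adj⁺ {a} {b} a≢v b≢v ab with a ≟ᶠ v | b ≟ᶠ v
  ... | no _    | no _    = ab
  ... | yes a≡v | _       = contradiction a≡v a≢v
  ... | no _    | yes b≡v = contradiction b≡v b≢v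

  isolate-¬adjʳ : ∀ {a} → ¬ T (adj (isolate G v) a v)
  isolate-¬adjʳ {a} av with a ≟ᶠ v | v ≟ᶠ v
  ... | no _  | no v≢v = v≢v refl
  ... | yes _ | _      = av
  ... | no _  | yes _  = av

  isolate-deg-< : ∀ {u} → T (adj G u v) → deg (isolate G v) u < deg G u
  isolate-deg-< {u} uv =
    length-filterᵇ-mono-< (λ x → isolate-adj⁻ {u} {x}) (∈-allFin v) (isolate-¬adjʳ {u}) uv

  isolate-size-< : ∀ {u} → T (adj G v u) → numV (isolate G v) + numE (isolate G v) < numV G + numE G
  isolate-size-< {u} vu = +-monoʳ-< (n G) (numE-< (<-cmp (toℕ v) (toℕ u)))
    where
    isolate-¬adjˡ : ∀ {b} → ¬ T (adj (isolate G v) v b)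
    isolate-¬adjˡ {b} vb = isolate-¬adjʳ {b} (adj-sym (isolate G v) {v} {b} vb)

    numE-< : Tri (toℕ v < toℕ u) (toℕ v ≡ toℕ u) (toℕ u < toℕ v) → numE (isolate G v) < numE G
    numE-< (tri< v<u _ _) = countPairs-mono-< (λ a b → isolate-adj⁻ {a} {b}) v<u (isolate-¬adjˡ {u}) vu
    numE-< (tri≈ _ v≡u _) = contradiction (toℕ-injective v≡u) (adj⇒≢ G vu)
    numE-< (tri> _ _ u<v) =
      countPairs-mono-< (λ a b → isolate-adj⁻ {a} {b}) u<v (isolate-¬adjʳ {u}) (adj-sym G vu)

  isolate-madLt3 : madLt3 G → madLt3 (isolate G v)
  isolate-madLt3 mad H = mad record
    { S = S H ; E = E H ; Esym = Esym H ; E⊆adj = λ a b ab → isolate-adj⁻ (E⊆adj H a b ab) ; E⊆S = E⊆S H }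

⊓-+-≤ : ∀ m x e → m ⊓ (x + e) ≤ m ⊓ x + e
⊓-+-≤ m x e = begin
  m ⊓ (x + e)        ≤⟨ ⊓-monoˡ-≤ (x + e) (m≤m+n m e) ⟩
  (m + e) ⊓ (x + e)  ≡⟨ sym (+-distribʳ-⊓ e m x) ⟩
  m ⊓ x + e          ∎
  where open ≤-Reasoning

⊓-transfer : ∀ m {d f f′ r r′} → m ⊓ (f′ + r′) ≤ d + r′ → f ≤ f′ → r′ ≤ r → m ⊓ (f + r) ≤ d + r
⊓-transfer m {d} {f} {f′} {r} {r′} seen′ f≤f′ r′≤r with m≤n⇒∃[o]m+o≡n r′≤r
... | e , refl = begin
  m ⊓ (f + (r′ + e))   ≡⟨ cong₂ _⊓_ refl (sym (+-assoc f r′ e)) ⟩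
  m ⊓ (f + r′ + e)     ≤⟨ ⊓-monoʳ-≤ m (+-monoˡ-≤ e (+-monoˡ-≤ r′ f≤f′)) ⟩
  m ⊓ (f′ + r′ + e)    ≤⟨ ⊓-+-≤ m (f′ + r′) e ⟩
  m ⊓ (f′ + r′) + e    ≤⟨ +-monoˡ-≤ e seen′ ⟩
  d + r′ + e           ≡⟨ +-assoc d r′ e ⟩
  d + (r′ + e)         ∎
  where open ≤-Reasoning

module InsideOutside {m : ℕ} (K : List (Fin m)) where

  open DecMembership (_≟ᶠ_ {m}) using (_∈?_)

  inK : Fin m → Bool
  inK z = isYes (z ∈? K)

  insideOf : List (Fin m) → List (Fin m)
  insideOf = filterᵇ inK

  outsideOf : List (Fin m) → List (Fin m)
  outsideOf = filterᵇ (not ∘ inK)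

  ∈-insideOf⁺ : ∀ {z xs} → z ∈ xs → z ∈ K → z ∈ insideOf xs
  ∈-insideOf⁺ z∈xs z∈K = ∈-filterᵇ⁺ inK z∈xs (fromWitness z∈K)

  ∈-insideOf⁻ : ∀ xs {z} → z ∈ insideOf xs → z ∈ xs × z ∈ K
  ∈-insideOf⁻ xs z∈ = let z∈xs , z∈K = ∈-filterᵇ⁻ inK z∈ in z∈xs , toWitness z∈K

  ∈-outsideOf⁺ : ∀ {z xs} → z ∈ xs → z ∉ K → z ∈ outsideOf xs
  ∈-outsideOf⁺ z∈xs z∉K = ∈-filterᵇ⁺ (not ∘ inK) z∈xs (fromWitnessFalse z∉K)

  ∈-outsideOf⁻ : ∀ xs {z} → z ∈ outsideOf xs → z ∈ xs × z ∉ K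
  ∈-outsideOf⁻ xs z∈ = let z∈xs , z∉K = ∈-filterᵇ⁻ (not ∘ inK) z∈ in z∈xs , toWitnessFalse z∉K

module Recolouring (G : Graph) (v : Fin (n G)) (K : List (Fin (n G))) (φ : Fin (n G) → ℕ) where

  open DecMembership (_≟ᶠ_ {n G}) using (_∈?_)
  open WithDecidableEquality (_≟ᶠ_ {n G}) using (Unique-⊆⇒length-≤)
  open InsideOutside K public

  coloursOutside : Fin (n G) → List ℕ
  coloursOutside y = deduplicate ℕ._≟_ (map φ (outsideOf (nbrs G y)))

  twoColoursOutside : Fin (n G) → List ℕ
  twoColoursOutside y = take 2 (coloursOutside y)

  module Lift (v∈K : v ∈ K) (φ-dynamic : Is3Dynamic (isolate G v) φ) (ψ : Fin (n G) → ℕ)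
    (ψ-outside : ∀ {z} → z ∉ K → ψ z ≡ φ z) (ψ-injective : InjectiveOn ψ K)
    (compatible : ∀ {r y} → r ∈ K → y ∉ K → T (adj G r y) → ψ r ∉ φ y ∷ twoColoursOutside y) where

    ∉K⇒≢v : ∀ {z} → z ∉ K → z ≢ v
    ∉K⇒≢v z∉K refl = z∉K v∈K

    proper : ∀ a b → T (adj G a b) → ψ a ≢ ψ b
    proper a b ab with a ∈? K | b ∈? K
    ... | yes a∈K | yes b∈K = λ eq → adj⇒≢ G ab (ψ-injective a∈K b∈K eq)
    ... | yes a∈K | no  b∉K = λ eq → compatible a∈K b∉K ab (here (trans eq (ψ-outside b∉K)))
    ... | no  a∉K | yes b∈K = λ eq → compatible b∈K a∉K (adj-sym G ab) (here (trans (sym eq) (ψ-outside a∉K)))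
    ... | no  a∉K | no  b∉K = λ eq → proj₁ φ-dynamic a b (isolate-adj⁺ G v (∉K⇒≢v a∉K) (∉K⇒≢v b∉K) ab)
                                         (trans (sym (ψ-outside a∉K)) (trans eq (ψ-outside b∉K)))

    module _ {y : Fin (n G)} (y∉K : y ∉ K) where

      private
        G′ = isolate G v
        D  = coloursOutside y
        F  = outsideOf (nbrs G y)
        R  = insideOf (nbrs G y)
        F′ = outsideOf (nbrs G′ y)
        R′ = insideOf (nbrs G′ y)

      coloursOutside⊆seen : D ⊆ map ψ (nbrs G y)
      coloursOutside⊆seen c∈D with ∈-map⁻ φ (∈-deduplicate⁻ ℕ._≟_ (map φ F) c∈D)
      ... | z , z∈F , refl = let z∈N , z∉K = ∈-outsideOf⁻ (nbrs G y) z∈F in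
        subst (_∈ map ψ (nbrs G y)) (ψ-outside z∉K) (∈-map⁺ ψ z∈N)

      many-colours-outside : 3 ≤ length D → 3 ⊓ deg G y ≤ coloursSeen G ψ y
      many-colours-outside three =
        ≤-trans (m⊓n≤m 3 _) (≤-trans three (length-deduplicate-≥ (deduplicate-! ℕ._≟_ _) coloursOutside⊆seen))

      module _ (few : length D ≤ 2) where

        -- With at most two colours outside K, twoColoursOutside y is all of them.
        recoloured-avoid-D : ∀ {c} → c ∈ D → c ∉ map ψ R
        recoloured-avoid-D c∈D c∈ψR with ∈-map⁻ ψ c∈ψR
        ... | r , r∈R , refl = let r∈N , r∈K = ∈-insideOf⁻ (nbrs G y) r∈R in
          compatible r∈K y∉K (adj-sym G (∈-nbrs⁻ G y r∈N)) (there (subst (_ ∈_) (sym (take-all 2 D few)) c∈D))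

        seen-≥ : length D + length R ≤ coloursSeen G ψ y
        seen-≥ = subst (_≤ coloursSeen G ψ y) (trans (length-++ D) (cong₂ _+_ refl (length-map ψ R)))
          (length-deduplicate-≥ D++ψR-unique D++ψR⊆seen)
          where
          D++ψR-unique : Unique (D ++ map ψ R)
          D++ψR-unique = Unique.++⁺ (deduplicate-! ℕ._≟_ _)
            (map⁺-injectiveOn (Unique.filter⁺ _ (nbrs-unique G y))
              (λ a∈R b∈R → ψ-injective (proj₂ (∈-insideOf⁻ (nbrs G y) a∈R)) (proj₂ (∈-insideOf⁻ (nbrs G y) b∈R))))
            (λ (c∈D , c∈ψR) → recoloured-avoid-D c∈D c∈ψR)
          D++ψR⊆seen : D ++ map ψ R ⊆ map ψ (nbrs G y)
          D++ψR⊆seen c∈ with ∈-++⁻ D c∈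
          ... | inj₁ c∈D  = coloursOutside⊆seen c∈D
          ... | inj₂ c∈ψR with ∈-map⁻ ψ c∈ψR
          ...   | r , r∈R , refl = ∈-map⁺ ψ (proj₁ (∈-insideOf⁻ (nbrs G y) r∈R))

        seen′-≤ : 3 ⊓ (length F′ + length R′) ≤ length D + length R′
        seen′-≤ = subst₂ _≤_ (cong (3 ⊓_) (sym (length-filterᵇ-partition inK (nbrs G′ y))))
                             (trans (length-++ D) (cong₂ _+_ refl (length-map φ R′)))
          (≤-trans (proj₂ φ-dynamic y) (length-deduplicate-≤ seen′⊆))
          where
          seen′⊆ : map φ (nbrs G′ y) ⊆ D ++ map φ R′
          seen′⊆ c∈ with ∈-map⁻ φ c∈
          ... | z , z∈N′ , refl with z ∈? K
          ...   | yes z∈K = ∈-++⁺ʳ D (∈-map⁺ φ (∈-insideOf⁺ z∈N′ z∈K))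
          ...   | no  z∉K = ∈-++⁺ˡ (∈-deduplicate⁺ ℕ._≟_
                              (∈-map⁺ φ (∈-outsideOf⁺ (∈-nbrs⁺ G y (isolate-adj⁻ G v (∈-nbrs⁻ G′ y z∈N′))) z∉K)))

        F⊆F′ : F ⊆ F′
        F⊆F′ z∈F = let z∈N , z∉K = ∈-outsideOf⁻ (nbrs G y) z∈F in
          ∈-outsideOf⁺ (∈-nbrs⁺ G′ y (isolate-adj⁺ G v (∉K⇒≢v y∉K) (∉K⇒≢v z∉K) (∈-nbrs⁻ G y z∈N))) z∉K

        R′⊆R : R′ ⊆ R
        R′⊆R z∈R′ = let z∈N′ , z∈K = ∈-insideOf⁻ (nbrs G′ y) z∈R′ in
          ∈-insideOf⁺ (∈-nbrs⁺ G y (isolate-adj⁻ G v (∈-nbrs⁻ G′ y z∈N′))) z∈K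

        few-colours-outside : 3 ⊓ deg G y ≤ coloursSeen G ψ y
        few-colours-outside = ≤-trans
          (subst (λ d → 3 ⊓ d ≤ length D + length R) (length-filterᵇ-partition inK (nbrs G y))
            (⊓-transfer 3 seen′-≤ (Unique-⊆⇒length-≤ (Unique.filter⁺ _ (nbrs-unique G y)) F⊆F′)
                                    (Unique-⊆⇒length-≤ (Unique.filter⁺ _ (nbrs-unique G′ y)) R′⊆R)))
          seen-≥

    dynamic-outside : ∀ {y} → y ∉ K → 3 ⊓ deg G y ≤ coloursSeen G ψ y
    dynamic-outside {y} y∉K with 3 ≤? length (coloursOutside y)
    ... | yes three = many-colours-outside y∉K three
    ... | no ¬three = few-colours-outside y∉K (≤-pred (≰⇒> ¬three))

module Extension (G : Graph) (v : Fin (n G)) (us : List (Fin (n G))) (us-unique : Unique us)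
  (us⊆nbrs : ∀ {u} → u ∈ us → T (adj G v u)) (us-deg2 : ∀ {u} → u ∈ us → deg G u ≡ 2)
  (3≤|us| : 3 ≤ length us) (|us|≤4 : length us ≤ 4) (deg-v : deg G v ≡ suc (length us)) where

  open DecMembership (_≟ᶠ_ {n G}) using (_∈?_)
  open WithDecidableEquality (_≟ᶠ_ {n G}) using (Unique-⊆⇒length-≤; ∃-∈-≢)

  private
    G′ = isolate G v
    K = v ∷ us

  us≢v : ∀ {u} → u ∈ us → u ≢ v
  us≢v u∈us refl = adj⇒≢ G (us⊆nbrs u∈us) refl

  deg′≤1 : ∀ {u} → u ∈ us → deg G′ u ≤ 1
  deg′≤1 {u} u∈us =
    ≤-pred (subst (deg G′ u <_) (us-deg2 u∈us) (isolate-deg-< G v {u} (adj-sym G (us⊆nbrs u∈us))))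

  open InsideOutside us using () renaming (outsideOf to outsideUs; insideOf to insideUs;
    ∈-outsideOf⁺ to ∈-outsideUs⁺; ∈-insideOf⁺ to ∈-insideUs⁺)

  otherNbrs : List (Fin (n G))
  otherNbrs = outsideUs (nbrs G v)

  |otherNbrs|≤1 : length otherNbrs ≤ 1
  |otherNbrs|≤1 = +-cancelʳ-≤ (length us) _ _ (begin
    length otherNbrs + length us                     ≤⟨ +-mono-≤ ℕ.≤-refl us≤inside ⟩
    length otherNbrs + length (insideUs (nbrs G v))  ≡⟨ length-filterᵇ-partition _ (nbrs G v) ⟩
    deg G v                                          ≡⟨ deg-v ⟩
    suc (length us)                                  ∎)
    where
    open ≤-Reasoning
    us≤inside : length us ≤ length (insideUs (nbrs G v))
    us≤inside = Unique-⊆⇒length-≤ us-unique (λ u∈us → ∈-insideUs⁺ (∈-nbrs⁺ G v (us⊆nbrs u∈us)) u∈us)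

  v∉us : v ∉ us
  v∉us v∈us = us≢v v∈us refl

  module Colouring (L : ListAssignment G) (L-unique : ∀ z → Unique (L z)) (L-size : ∀ z → 8 ≤ length (L z))
                   (φ : Fin (n G) → ℕ) (φ∈L : ∀ z → φ z ∈ L z) (φ-dynamic : Is3Dynamic G′ φ) where

    open Recolouring G v K φ using (coloursOutside; twoColoursOutside; module Lift)

    forbiddenNear : Fin (n G) → List ℕ
    forbiddenNear y = φ y ∷ twoColoursOutside y

    |forbiddenNear|≤3 : ∀ {y} → length (forbiddenNear y) ≤ 3
    |forbiddenNear|≤3 {y} = s≤s (subst (_≤ 2) (sym (length-take 2 (coloursOutside y))) (m⊓n≤m 2 _))

    -- The colour of v must differ from that of the other neighbour of each u ∈ us, which u sees besides v.
    forbidden-v : List ℕ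
    forbidden-v = concatMap (map φ ∘ nbrs G′) us ++ concatMap forbiddenNear otherNbrs

    forbidden-u : Fin (n G) → List ℕ
    forbidden-u u = concatMap forbiddenNear (nbrs G′ u)

    |forbidden-v|≤7 : length forbidden-v ≤ 7
    |forbidden-v|≤7 = begin
      length forbidden-v                                   ≡⟨ length-++ (concatMap (map φ ∘ nbrs G′) us) ⟩
      length (concatMap (map φ ∘ nbrs G′) us) + length (concatMap forbiddenNear otherNbrs)
        ≤⟨ +-mono-≤ (length-concatMap-≤ (map φ ∘ nbrs G′) 1 us
                       (λ {u} u∈us → subst (_≤ 1) (sym (length-map φ (nbrs G′ u))) (deg′≤1 u∈us)))
                    (length-concatMap-≤ forbiddenNear 3 otherNbrs (λ _ → |forbiddenNear|≤3)) ⟩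
      length us * 1 + length otherNbrs * 3
        ≤⟨ +-mono-≤ (*-monoˡ-≤ 1 |us|≤4) (*-monoˡ-≤ 3 |otherNbrs|≤1) ⟩
      7                                                    ∎
      where open ≤-Reasoning

    cv-fresh : ∃[ c ] c ∈ L v × c ∉ forbidden-v
    cv-fresh = fresh (L-unique v) (<-≤-trans (s≤s |forbidden-v|≤7) (L-size v))

    cv : ℕ
    cv = proj₁ cv-fresh

    blocked : Fin (n G) → List ℕ
    blocked u = cv ∷ forbidden-u u

    room : ∀ {u} → u ∈ us → length (blocked u) + length us ≤ length (L u)
    room {u} u∈us = ≤-trans (+-mono-≤ (s≤s |forbidden-u|≤3) |us|≤4) (L-size u)
      where
      |forbidden-u|≤3 : length (forbidden-u u) ≤ 3
      |forbidden-u|≤3 = ≤-trans (length-concatMap-≤ forbiddenNear 3 (nbrs G′ u) (λ _ → |forbiddenNear|≤3))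
                                (*-monoˡ-≤ 3 (deg′≤1 u∈us))

    open DistinctChoice (distinctChoice L blocked L-unique (updateAt φ v (const cv)) us-unique room)
      renaming (colour to ψ)

    ψ-v : ψ v ≡ cv
    ψ-v = trans (unchanged v∉us) (updateAt-updates v φ)

    ψ-outside : ∀ {z} → z ∉ K → ψ z ≡ φ z
    ψ-outside z∉K = trans (unchanged (z∉K ∘ there)) (updateAt-minimal _ v φ (z∉K ∘ here))

    ψ-us≢cv : ∀ {u} → u ∈ us → ψ u ≢ cv
    ψ-us≢cv u∈us eq = avoids u∈us (here eq)

    ψ-injective : InjectiveOn ψ K
    ψ-injective (here refl)  (here refl)  _  = refl
    ψ-injective (here refl)  (there u∈us) eq = contradiction (trans (sym eq) ψ-v) (ψ-us≢cv u∈us)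
    ψ-injective (there u∈us) (here refl)  eq = contradiction (trans eq ψ-v) (ψ-us≢cv u∈us)
    ψ-injective (there a∈us) (there b∈us) eq = injective a∈us b∈us eq

    ψ∈L : ∀ z → ψ z ∈ L z
    ψ∈L z with z ∈? us | z ≟ᶠ v
    ... | yes z∈us | _        = allowed z∈us
    ... | no  _    | yes refl = subst (_∈ L v) (sym ψ-v) (proj₁ (proj₂ cv-fresh))
    ... | no  z∉us | no  z≢v  =
      subst (_∈ L z) (sym (ψ-outside λ { (here z≡v) → z≢v z≡v ; (there z∈us) → z∉us z∈us })) (φ∈L z)

    compatible : ∀ {r y} → r ∈ K → y ∉ K → T (adj G r y) → ψ r ∉ forbiddenNear y
    compatible (here refl) y∉K vy rewrite ψ-v = λ cv∈ → proj₂ (proj₂ cv-fresh)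
      (∈-++⁺ʳ _ (∈-concatMap⁺ forbiddenNear (∈-outsideUs⁺ (∈-nbrs⁺ G v vy) (y∉K ∘ there)) cv∈))
    compatible {r} (there u∈us) y∉K uy = λ ψu∈ → avoids u∈us
      (there (∈-concatMap⁺ forbiddenNear (∈-nbrs⁺ G′ r (isolate-adj⁺ G v (us≢v u∈us) (y∉K ∘ here) uy)) ψu∈))

    open Lift (here refl) φ-dynamic ψ ψ-outside ψ-injective compatible using (proper; dynamic-outside)

    dynamic-v : 3 ⊓ deg G v ≤ coloursSeen G ψ v
    dynamic-v = ≤-trans (m⊓n≤m 3 _) (≤-trans 3≤|us| (subst (_≤ coloursSeen G ψ v) (length-map ψ us)
      (length-deduplicate-≥ (map⁺-injectiveOn us-unique (λ a∈us b∈us → ψ-injective (there a∈us) (there b∈us)))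
                            (⊆-map⁺ ψ (λ u∈us → ∈-nbrs⁺ G v (us⊆nbrs u∈us))))))

    dynamic-us : ∀ {u} → u ∈ us → 3 ⊓ deg G u ≤ coloursSeen G ψ u
    dynamic-us {u} u∈us with ∃-∈-≢ (nbrs-unique G u) (subst (2 ≤_) (sym (us-deg2 u∈us)) ℕ.≤-refl) v
    ... | w , w∈N , w≢v = subst (λ d → 3 ⊓ d ≤ coloursSeen G ψ u) (sym (us-deg2 u∈us))
                            (length-deduplicate-≥ ((cv≢ψw ∷ []) ∷ [] ∷ []) seen)
      where
      w∉K⇒cv≢ψw : w ∉ K → cv ≢ ψ w
      w∉K⇒cv≢ψw w∉K cv≡ψw = proj₂ (proj₂ cv-fresh) (∈-++⁺ˡ (∈-concatMap⁺ (map φ ∘ nbrs G′) u∈us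
        (subst (_∈ map φ (nbrs G′ u)) (sym (trans cv≡ψw (ψ-outside w∉K)))
          (∈-map⁺ φ (∈-nbrs⁺ G′ u (isolate-adj⁺ G v (us≢v u∈us) w≢v (∈-nbrs⁻ G u w∈N)))))))

      cv≢ψw : cv ≢ ψ w
      cv≢ψw with w ∈? us
      ... | yes w∈us = ψ-us≢cv w∈us ∘ sym
      ... | no  w∉us = w∉K⇒cv≢ψw λ { (here w≡v) → w≢v w≡v ; (there w∈us) → w∉us w∈us }

      seen : cv ∷ ψ w ∷ [] ⊆ map ψ (nbrs G u)
      seen (here refl)         =
        subst (_∈ map ψ (nbrs G u)) ψ-v (∈-map⁺ ψ (∈-nbrs⁺ G u (adj-sym G (us⊆nbrs u∈us))))
      seen (there (here refl)) = ∈-map⁺ ψ w∈N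

    dynamic : ∀ y → min 3 (deg G y) ≤ coloursSeen G ψ y
    dynamic y with y ∈? K
    ... | yes (here refl)  = dynamic-v
    ... | yes (there y∈us) = dynamic-us y∈us
    ... | no  y∉K          = dynamic-outside y∉K

    colouring : Σ (Fin (n G) → ℕ) λ ψ → (∀ z → ψ z ∈ L z) × Is3Dynamic G ψ
    colouring = ψ , ψ∈L , proper , dynamic

  extension : Choosable3d G′ 8 → Choosable3d G 8
  extension choosable′ L L-unique L-size =
    let φ , φ∈L , φ-dynamic = choosable′ L L-unique L-size in
    Colouring.colouring L L-unique L-size φ φ∈L φ-dynamic

choosable-mono : ∀ {G k l} → k ≤ l → Choosable3d G k → Choosable3d G l
choosable-mono k≤l choosable L L-unique L-size = choosable L L-unique (λ z → ≤-trans k≤l (L-size z))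

minimalBad-irreducible : ∀ {G} → MinimalBad G → (G′ : Graph) → madLt3 G′ →
  numV G′ + numE G′ < numV G + numE G → (Choosable3d G′ 8 → Choosable3d G 8) → ⊥
minimalBad-irreducible ((_ , ch≥9) , minimal) G′ mad′ smaller transfer =
  <⇒≱ smaller (minimal G′ (mad′ , ch′≥9))
  where
  ch′≥9 : ch3dGe G′ 9
  ch′≥9 k choosable with k ≤? 8
  ... | yes k≤8 = contradiction (ch≥9 8 (transfer (choosable-mono {G = G′} k≤8 choosable))) (<-irrefl refl)
  ... | no  k≰8 = ≰⇒> k≰8

minimalBad⇒deg2Nbrs< : ∀ {G} → MinimalBad G → ∀ {d} → 3 ≤ d → d ≤ 4 →
  (v : Fin (n G)) → deg G v ≡ suc d → deg2Nbrs G v < d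
minimalBad⇒deg2Nbrs< {G} minimal {d} 3≤d d≤4 v deg-v with d ≤? deg2Nbrs G v
... | no  d≰ = ≰⇒> d≰
... | yes d≤ = ⊥-elim (minimalBad-irreducible minimal (isolate G v)
                 (isolate-madLt3 G v (proj₁ (proj₁ minimal)))
                 (isolate-size-< G v (us⊆nbrs (∈-lookup (fromℕ< (≤-trans (s≤s z≤n) 3≤|us|)))))
                 (Extension.extension G v us us-unique us⊆nbrs us-deg2 3≤|us| |us|≤4
                   (trans deg-v (cong suc (sym |us|≡d)))))
  where
  degree2 : Fin (n G) → Bool
  degree2 u = adj G v u ∧ (deg G u ≡ᵇ 2)

  us : List (Fin (n G))
  us = take d (filterᵇ degree2 (allFin (n G)))

  |us|≡d : length us ≡ d
  |us|≡d = trans (length-take d _) (m≤n⇒m⊓n≡m d≤)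

  3≤|us| : 3 ≤ length us
  3≤|us| = subst (3 ≤_) (sym |us|≡d) 3≤d

  |us|≤4 : length us ≤ 4
  |us|≤4 = subst (_≤ 4) (sym |us|≡d) d≤4

  us-unique : Unique us
  us-unique = Unique.take⁺ d (Unique.filter⁺ _ (Unique.allFin⁺ (n G)))

  us-degree2 : ∀ {u} → u ∈ us → T (adj G v u) × T (deg G u ≡ᵇ 2)
  us-degree2 u∈us = Equivalence.to T-∧ (proj₂ (∈-filterᵇ⁻ degree2 {xs = allFin (n G)} (∈-take⁻ d _ u∈us)))

  us⊆nbrs : ∀ {u} → u ∈ us → T (adj G v u)
  us⊆nbrs = proj₁ ∘ us-degree2

  us-deg2 : ∀ {u} → u ∈ us → deg G u ≡ 2
  us-deg2 u∈us = ≡ᵇ⇒≡ _ 2 (proj₂ (us-degree2 u∈us))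

lemma5p2 : (G : Graph) → MinimalBad G →
    (k : ℕ) → (k ≡ 4 ⊎ k ≡ 5) →
    (v : Fin (n G)) → deg G v ≡ k → deg2Nbrs G v + 2 ≤ k
lemma5p2 G minimal .4 (inj₁ refl) v deg-v =
  +-monoˡ-≤ 2 (s≤s⁻¹ (minimalBad⇒deg2Nbrs< minimal ≤-refl (n≤1+n 3) v deg-v))
lemma5p2 G minimal .5 (inj₂ refl) v deg-v =
  +-monoˡ-≤ 2 (s≤s⁻¹ (minimalBad⇒deg2Nbrs< minimal (n≤1+n 3) ≤-refl v deg-v))
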